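{- Let $G$ be a finite, simple, connected graph, let $d\ge1$, and let $H_0\sim H_1\sim\dots\sim H_d$ be a path in the clique graph $\Gamma(G)$ with $d_{\Gamma(G)}(H_0,H_d)=d$. For $1\le i\le d$ choose a vertex $x_i\in H_{i-1}\cap H_i$. Then $x_1\sim x_2\sim\dots\sim x_d$ in $G$ (consecutive vertices adjacent) and $d_G(x_1,x_d)=d-1$. Hence this is a shortest path in $G$ connecting $x_1$ and $x_d$, and $x_1,\dots,x_d$ are mutually distinct.
   Context: $d_G$ denotes graph distance in $G$. A clique is a nonempty vertex subset inducing a complete graph; a maximal clique is one maximal under inclusion. The clique graph $\Gamma(G)$ has as vertices the maximal cliques of $G$, with two maximal cliques $H_1,H_2$ adjacent (written $H_1\sim H_2$) iff $H_1\neq H_2$ and $H_1\cap H_2\neq\emptyset$; $d_{\Gamma(G)}$ is its graph distance. -}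

module Defs where

open import Data.Nat using (ℕ; zero; suc; _≤_; _<_; _∸_)
open import Data.Fin using (Fin)
open import Data.Fin.Subset using (Subset; _∈_; _⊆_; _∩_; Nonempty)
open import Data.Product using (_×_; ∃)
open import Relation.Binary.PropositionalEquality using (_≡_; _≢_)
open import Relation.Nullary using (¬_; Dec)

record Graph (n : ℕ) : Set₁ where
  field
    Adj   : Fin n → Fin n → Set
    adj?  : ∀ x y → Dec (Adj x y)
    sym   : ∀ {x y} → Adj x y → Adj y x
    irrefl : ∀ {x} → ¬ Adj x x
open Graph public

data Walk {A : Set} (R : A → A → Set) : A → A → ℕ → Set where
  here : ∀ {x} → Walk R x x zero
  step : ∀ {x y z k} → R x y → Walk R y z k → Walk R x z (suc k)

Dist : {A : Set} (R : A → A → Set) → A → A → ℕ → Set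
Dist R x y k = Walk R x y k × (∀ m → Walk R x y m → k ≤ m)

Connected : ∀ {n} → Graph n → Set
Connected G = ∀ x y → ∃ λ k → Walk (Adj G) x y k

IsClique : ∀ {n} → Graph n → Subset n → Set
IsClique G H = Nonempty H × (∀ x y → x ∈ H → y ∈ H → x ≢ y → Adj G x y)

IsMaxClique : ∀ {n} → Graph n → Subset n → Set
IsMaxClique G H = IsClique G H × (∀ K → IsClique G K → H ⊆ K → K ≡ H)

-- Adjacency in the clique graph Γ(G): two distinct maximal cliques
-- with nonempty intersection.  (Walks in this relation on Subset n are
-- exactly walks in Γ(G), since every step requires both ends maximal.)
ΓAdj : ∀ {n} → Graph n → Subset n → Subset n → Set
ΓAdj G H₁ H₂ = IsMaxClique G H₁ × IsMaxClique G H₂ × H₁ ≢ H₂ × Nonempty (H₁ ∩ H₂)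

{-# OPTIONS --safe #-}
module Submission where

-- Two maximal cliques sharing a vertex are at distance at most 1 in Γ(G),
-- and every edge of G lies in a maximal clique, so a walk of length m in G
-- from a vertex of H₀ to a vertex of H_d lifts to a walk of length at most
-- m + 1 in Γ(G); hence d_G(x₁, x_d) ≥ d - 1.  Since H₀ ∼ ⋯ ∼ H_d is a
-- geodesic, x_i = x_j with i < j would give the shortcut H_{i-1} ∼ H_j, so
-- the x_i are distinct, and x_i, x_{i+1} are adjacent as distinct vertices
-- of the clique H_i.

open import Defs
open import Data.Nat using (ℕ; zero; suc; _+_; _≤_; _<_; _∸_; z≤n; s≤s)
open import Data.Nat.Properties
  using (≤-refl; ≤-trans; <-≤-trans; +-mono-≤; <-cmp; +-identityʳ; +-suc; +-comm; +-monoʳ-≤;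
         +-cancelʳ-≤; m≤m+n; m<n⇒m<1+n; n<1+n; n≤1+n; <⇒≱; <⇒≤; ∸-monoˡ-≤;
         m≤n⇒∃[o]m+o≡n; module ≤-Reasoning)
open import Data.Fin using (Fin)
open import Data.Fin.Properties using (any?; all?)
open import Data.Fin.Subset using (Subset; _∈_; _∉_; _⊆_; _⊂_; _⊃_; _∪_; ⁅_⁆)
open import Data.Fin.Subset.Properties
  using (_∈?_; ⊆-antisym; p⊆p∪q; q⊆p∪q; x∈p∪q⁻; x∈⁅x⁆; x∈⁅y⁆⇒x≡y; x≢y⇒x∉⁅y⁆; x∈p∩q⁺)
open import Data.Fin.Subset.Induction using (⊃-wellFounded)
open import Data.Bool.Properties using () renaming (_≟_ to _≟ᵇ_)
open import Data.Vec.Properties using (≡-dec)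
open import Data.Product using (_×_; _,_; ∃; proj₁; proj₂)
open import Data.Sum using (inj₁; inj₂)
open import Data.Empty using (⊥-elim)
open import Function using (_∘_; id)
open import Induction.WellFounded using (Acc; acc)
open import Relation.Binary using (tri<; tri≈; tri>)
open import Relation.Binary.PropositionalEquality as ≡ using (_≡_; _≢_; refl; subst)
open import Relation.Nullary using (¬_; Dec; yes; no)
open import Relation.Nullary.Decidable using (_→-dec_; _×-dec_; ¬?)

module _ {A : Set} {R : A → A → Set} where

  infixr 5 _++_
  infixl 5 _▷_

  _++_ : ∀ {x y z a b} → Walk R x y a → Walk R y z b → Walk R x z (a + b)
  here     ++ w = w
  step r v ++ w = step r (v ++ w)

  _▷_ : ∀ {x y z k} → Walk R x y k → R y z → Walk R x z (suc k)
  here     ▷ r = step r here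
  step s w ▷ r = step s (w ▷ r)

  Walk≤ : A → A → ℕ → Set
  Walk≤ x y b = ∃ λ k → k ≤ b × Walk R x y k

  _++≤_ : ∀ {x y z a b} → Walk≤ x y a → Walk≤ y z b → Walk≤ x z (a + b)
  (k , k≤a , v) ++≤ (l , l≤b , w) = k + l , +-mono-≤ k≤a l≤b , v ++ w

  module _ (v : ℕ → A) where

    segment : ∀ a k → (∀ i → a ≤ i → i < a + k → R (v i) (v (suc i))) →
              Walk R (v a) (v (a + k)) k
    segment a zero    _ rewrite +-identityʳ a = here
    segment a (suc k) r rewrite +-suc a k =
      segment a k (λ i a≤i i<a+k → r i a≤i (m<n⇒m<1+n i<a+k))
        ▷ r (a + k) (m≤m+n a k) (n<1+n (a + k))

    geodesic-segment : ∀ {d} → Dist R (v 0) (v d) d → (∀ i → i < d → R (v i) (v (suc i))) →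
                       ∀ {a b m} → a ≤ b → b ≤ d → Walk R (v a) (v b) m → b ≤ a + m
    geodesic-segment (_ , shortest) r {a} {m = m} a≤b b≤d w
      with o , refl ← m≤n⇒∃[o]m+o≡n a≤b
      with p , refl ← m≤n⇒∃[o]m+o≡n b≤d =
      +-cancelʳ-≤ p (a + o) (a + m) (shortest _ shortcut)
      where
      shortcut : Walk R (v 0) (v (a + o + p)) (a + m + p)
      shortcut = (segment 0 a (λ i _ i<a → r i (<a⇒<d i<a)) ++ w)
              ++ segment (a + o) p (λ i _ i<d → r i i<d)
        where
        <a⇒<d : ∀ {i} → i < a → i < a + o + p
        <a⇒<d i<a = <-≤-trans i<a (≤-trans (m≤m+n a o) (m≤m+n (a + o) p))

x∉p⇒p⊂p∪⁅x⁆ : ∀ {n} {p : Subset n} {x} → x ∉ p → p ⊂ p ∪ ⁅ x ⁆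
x∉p⇒p⊂p∪⁅x⁆ {p = p} {x} x∉p = p⊆p∪q ⁅ x ⁆ , x , q⊆p∪q p ⁅ x ⁆ (x∈⁅x⁆ x) , x∉p

module _ {n} (G : Graph n) where

  Extends : Subset n → Fin n → Set
  Extends K w = w ∉ K × (∀ z → z ∈ K → Adj G w z)

  extends? : ∀ K → Dec (∃ (Extends K))
  extends? K = any? λ w → ¬? (w ∈? K) ×-dec all? λ z → (z ∈? K) →-dec adj? G w z

  ⁅⁆-isClique : ∀ u → IsClique G ⁅ u ⁆
  ⁅⁆-isClique u = (u , x∈⁅x⁆ u) , λ x y x∈ y∈ x≢y →
    ⊥-elim (x≢y (≡.trans (x∈⁅y⁆⇒x≡y u x∈) (≡.sym (x∈⁅y⁆⇒x≡y u y∈))))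

  ∪⁅⁆-isClique : ∀ {K w} → IsClique G K → Extends K w → IsClique G (K ∪ ⁅ w ⁆)
  ∪⁅⁆-isClique {K} {w} ((u , u∈K) , clique) (_ , w∼K) = (u , p⊆p∪q ⁅ w ⁆ u∈K) , pairwise
    where
    pairwise : ∀ x y → x ∈ K ∪ ⁅ w ⁆ → y ∈ K ∪ ⁅ w ⁆ → x ≢ y → Adj G x y
    pairwise x y x∈ y∈ x≢y with x∈p∪q⁻ K ⁅ w ⁆ x∈ | x∈p∪q⁻ K ⁅ w ⁆ y∈
    ... | inj₁ x∈K | inj₁ y∈K = clique x y x∈K y∈K x≢y
    ... | inj₁ x∈K | inj₂ y∈w rewrite x∈⁅y⁆⇒x≡y w y∈w = sym G (w∼K x x∈K)
    ... | inj₂ x∈w | inj₁ y∈K rewrite x∈⁅y⁆⇒x≡y w x∈w = w∼K y y∈K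
    ... | inj₂ x∈w | inj₂ y∈w = ⊥-elim (x≢y (≡.trans (x∈⁅y⁆⇒x≡y w x∈w) (≡.sym (x∈⁅y⁆⇒x≡y w y∈w))))

  unextendable⇒isMaxClique : ∀ {K} → IsClique G K → ¬ ∃ (Extends K) → IsMaxClique G K
  unextendable⇒isMaxClique {K} isClique ∄w = isClique , λ L (_ , clique) K⊆L →
    ⊆-antisym (λ {w} w∈L → K-absorbs clique K⊆L w∈L) K⊆L
    where
    K-absorbs : ∀ {L w} → (∀ x y → x ∈ L → y ∈ L → x ≢ y → Adj G x y) → K ⊆ L → w ∈ L → w ∈ K
    K-absorbs {w = w} clique K⊆L w∈L with w ∈? K
    ... | yes w∈K = w∈K
    ... | no  w∉K = ⊥-elim (∄w (w , w∉K , λ z z∈K →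
                      clique w z w∈L (K⊆L z∈K) λ { refl → w∉K z∈K }))

  clique⊆maxClique : ∀ {K} → IsClique G K → ∃ λ M → IsMaxClique G M × K ⊆ M
  clique⊆maxClique {K} = grow (⊃-wellFounded K)
    where
    grow : ∀ {K} → Acc _⊃_ K → IsClique G K → ∃ λ M → IsMaxClique G M × K ⊆ M
    grow {K} (acc larger) isClique with extends? K
    ... | no ∄w = K , unextendable⇒isMaxClique isClique ∄w , id
    ... | yes (w , w∉K , w∼K) =
      let M , isMax , K∪w⊆M = grow (larger (x∉p⇒p⊂p∪⁅x⁆ w∉K)) (∪⁅⁆-isClique isClique (w∉K , w∼K))
      in M , isMax , K∪w⊆M ∘ p⊆p∪q ⁅ w ⁆

  edge⊆maxClique : ∀ {u v} → Adj G u v → ∃ λ M → IsMaxClique G M × u ∈ M × v ∈ M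
  edge⊆maxClique {u} {v} u∼v =
    let M , isMax , uv⊆M = clique⊆maxClique (∪⁅⁆-isClique (⁅⁆-isClique u) v-extends)
    in M , isMax , uv⊆M (p⊆p∪q ⁅ v ⁆ (x∈⁅x⁆ u)) , uv⊆M (q⊆p∪q ⁅ u ⁆ ⁅ v ⁆ (x∈⁅x⁆ v))
    where
    v-extends : Extends ⁅ u ⁆ v
    v-extends = x≢y⇒x∉⁅y⁆ (λ { refl → irrefl G u∼v }) ,
                λ z z∈u → subst (Adj G v) (≡.sym (x∈⁅y⁆⇒x≡y u z∈u)) (sym G u∼v)

  shared-vertex⇒Walk≤1 : ∀ {A B x} → IsMaxClique G A → IsMaxClique G B → x ∈ A → x ∈ B →
                         Walk≤ {R = ΓAdj G} A B 1
  shared-vertex⇒Walk≤1 {A} {B} {x} isMaxA isMaxB x∈A x∈B with ≡-dec _≟ᵇ_ A B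
  ... | yes refl = 0 , z≤n , here
  ... | no  A≢B  = 1 , ≤-refl , step (isMaxA , isMaxB , A≢B , x , x∈p∩q⁺ (x∈A , x∈B)) here

  lift-walk : ∀ {y z m A B} → Walk (Adj G) y z m →
              IsMaxClique G A → y ∈ A → IsMaxClique G B → z ∈ B →
              Walk≤ {R = ΓAdj G} A B (suc m)
  lift-walk here isMaxA y∈A isMaxB z∈B = shared-vertex⇒Walk≤1 isMaxA isMaxB y∈A z∈B
  lift-walk (step y∼y′ w) isMaxA y∈A isMaxB z∈B =
    let M , isMaxM , y∈M , y′∈M = edge⊆maxClique y∼y′
    in shared-vertex⇒Walk≤1 isMaxA isMaxM y∈A y∈M ++≤ lift-walk w isMaxM y′∈M isMaxB z∈B

module GeodesicCliquePath {n} (G : Graph n) {d : ℕ} {H : ℕ → Subset n} {x : ℕ → Fin n}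
         (H-max : ∀ i → i ≤ d → IsMaxClique G (H i))
         (H-step : ∀ i → i < d → ΓAdj G (H i) (H (suc i)))
         (H-geodesic : Dist (ΓAdj G) (H 0) (H d) d)
         (x∈H : ∀ i → 1 ≤ i → i ≤ d → x i ∈ H (i ∸ 1) × x i ∈ H i) where

  x-distinct-< : ∀ {i j} → 1 ≤ i → i < j → j ≤ d → x i ≢ x j
  x-distinct-< {suc i} {j} _ i<j j≤d xi≡xj =
    no-shortcut (shared-vertex⇒Walk≤1 G (H-max i i≤d) (H-max j j≤d) xi∈Hi xi∈Hj)
    where
    open ≤-Reasoning
    i≤j : i ≤ j
    i≤j = ≤-trans (n≤1+n i) (<⇒≤ i<j)
    i≤d : i ≤ d
    i≤d = ≤-trans i≤j j≤d
    xi∈Hi : x (suc i) ∈ H i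
    xi∈Hi = proj₁ (x∈H (suc i) (s≤s z≤n) (≤-trans (<⇒≤ i<j) j≤d))
    xi∈Hj : x (suc i) ∈ H j
    xi∈Hj = subst (_∈ H j) (≡.sym xi≡xj) (proj₂ (x∈H j (≤-trans (s≤s z≤n) i<j) j≤d))
    no-shortcut : ¬ Walk≤ {R = ΓAdj G} (H i) (H j) 1
    no-shortcut (k , k≤1 , shortcut) = <⇒≱ i<j (begin
      j      ≤⟨ geodesic-segment H H-geodesic H-step i≤j j≤d shortcut ⟩
      i + k  ≤⟨ +-monoʳ-≤ i k≤1 ⟩
      i + 1  ≡⟨ +-comm i 1 ⟩
      suc i  ∎)

  x-injective : ∀ i j → 1 ≤ i → i ≤ d → 1 ≤ j → j ≤ d → x i ≡ x j → i ≡ j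
  x-injective i j 1≤i i≤d 1≤j j≤d xi≡xj with <-cmp i j
  ... | tri< i<j _ _ = ⊥-elim (x-distinct-< 1≤i i<j j≤d xi≡xj)
  ... | tri≈ _ i≡j _ = i≡j
  ... | tri> _ _ j<i = ⊥-elim (x-distinct-< 1≤j j<i i≤d (≡.sym xi≡xj))

  x-adjacent : ∀ i → 1 ≤ i → i < d → Adj G (x i) (x (suc i))
  x-adjacent i 1≤i i<d = proj₂ (proj₁ (H-max i (<⇒≤ i<d))) (x i) (x (suc i))
    (proj₂ (x∈H i 1≤i (<⇒≤ i<d))) (proj₁ (x∈H (suc i) (s≤s z≤n) i<d))
    (x-distinct-< 1≤i (n<1+n i) i<d)

  x-walk-length : 1 ≤ d → ∀ m → Walk (Adj G) (x 1) (x d) m → d ∸ 1 ≤ m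
  x-walk-length 1≤d m w =
    let k , k≤1+m , lifted = lift-walk G w (H-max 0 z≤n) (proj₁ (x∈H 1 ≤-refl 1≤d))
                                           (H-max d ≤-refl) (proj₂ (x∈H d 1≤d ≤-refl))
    in ∸-monoˡ-≤ 1 (≤-trans (proj₂ H-geodesic k lifted) k≤1+m)

lemma3p6 : ∀ {n} (G : Graph n) → Connected G →
    (d : ℕ) → 1 ≤ d →
    (H : ℕ → Subset n) →
    (∀ i → i ≤ d → IsMaxClique G (H i)) →
    (∀ i → i < d → ΓAdj G (H i) (H (suc i))) →
    Dist (ΓAdj G) (H 0) (H d) d →
    (x : ℕ → Fin n) →
    (∀ i → 1 ≤ i → i ≤ d → x i ∈ H (i ∸ 1) × x i ∈ H i) →
    (∀ i → 1 ≤ i → i < d → Adj G (x i) (x (suc i)))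
    × Dist (Adj G) (x 1) (x d) (d ∸ 1)
    × (∀ i j → 1 ≤ i → i ≤ d → 1 ≤ j → j ≤ d → x i ≡ x j → i ≡ j)
lemma3p6 G _ (suc d) 1≤d H H-max H-step H-geodesic x x∈H =
  x-adjacent , (segment x 1 d x-adjacent , x-walk-length 1≤d) , x-injective
  where open GeodesicCliquePath G H-max H-step H-geodesic x∈H
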